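{- Let $A$ be an integer weighing matrix whose H-equivalence class $[A]$ is symmetric. Then $[A]$ contains a symmetric matrix if and only if the exact sequence $1\to\mathrm{Aut}(A)\to\mathrm{TAut}(A)\to\mathbb Z/2\to1$ splits.
   Context: An integer weighing matrix is $A\in\mathbb Z^{n\times n}$ with $AA^\top=kI$. $\mathrm{Mon}(n)$: monomial $n\times n$ matrices with entries in $\{0,\pm1\}$. $[A]=\{LAR^\top:L,R\in\mathrm{Mon}(n)\}$; it is a symmetric class if $A^\top\in[A]$. $\mathrm{Aut}(A)=\{(L,R)\in\mathrm{Mon}(n)^2:LAR^\top=A\}$. $\mathrm{TAut}(A)$ is the group whose elements are the pairs in $\mathrm{Aut}(A)$ and formal triples $(L,R,\top)$ with $L,R\in\mathrm{Mon}(n)$ and $LA^\top R^\top=A$, with multiplication given by composing the operations $X\mapsto LXR^\top$ and $X\mapsto LX^\top R^\top$: $(L_1,R_1)(L_2,R_2)=(L_1L_2,R_1R_2)$, $(L_1,R_1)(L_2,R_2,\top)=(L_1L_2,R_1R_2,\top)$, $(L_1,R_1,\top)(L_2,R_2)=(L_1R_2,R_1L_2,\top)$, $(L_1,R_1,\top)(L_2,R_2,\top)=(L_1R_2,R_1L_2)$. The map $\mathrm{TAut}(A)\to\mathbb Z/2$ sends pairs to $0$ and triples to $1$. The sequence splits if there is a homomorphism $s:\mathbb Z/2\to\mathrm{TAut}(A)$ whose composition with this map is the identity. -}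

module Defs where

open import Data.Nat using (ℕ; zero; suc)
open import Data.Fin using (Fin; zero; suc)
open import Data.Integer using (ℤ; +_; -[1+_]; _+_; _*_)
open import Data.Product using (Σ; ∃; ∃-syntax; _×_; _,_)
open import Data.Sum using (_⊎_)
open import Data.Empty using (⊥)
open import Relation.Binary.PropositionalEquality using (_≡_; _≢_)
open import Relation.Nullary using (Dec; yes; no)
open import Data.Fin using (_≟_)

Mat : ℕ → Set
Mat n = Fin n → Fin n → ℤ

∑ : ∀ {n} → (Fin n → ℤ) → ℤ
∑ {zero}  f = + 0
∑ {suc n} f = f zero + ∑ (λ i → f (suc i))

_·_ : ∀ {n} → Mat n → Mat n → Mat n
(A · B) i j = ∑ (λ k → A i k * B k j)

infixl 7 _·_

_ᵀ : ∀ {n} → Mat n → Mat n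
(A ᵀ) i j = A j i

scalarI : ∀ {n} → ℤ → Mat n
scalarI k i j with i ≟ j
... | yes _ = k
... | no  _ = + 0

I : ∀ {n} → Mat n
I = scalarI (+ 1)

_≈_ : ∀ {n} → Mat n → Mat n → Set
A ≈ B = ∀ i j → A i j ≡ B i j

infix 4 _≈_

IsWeighing : ∀ {n} → Mat n → Set
IsWeighing A = ∃[ k ] (A · A ᵀ ≈ scalarI k)

IsSignEntry : ℤ → Set
IsSignEntry x = (x ≡ + 0) ⊎ ((x ≡ + 1) ⊎ (x ≡ -[1+ 0 ]))

IsMonomial : ∀ {n} → Mat n → Set
IsMonomial {n} M =
  (∀ i j → IsSignEntry (M i j)) ×
  ((∀ i → ∃[ j ] (M i j ≢ + 0 × (∀ j' → j' ≢ j → M i j' ≡ + 0))) ×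
   (∀ j → ∃[ i ] (M i j ≢ + 0 × (∀ i' → i' ≢ i → M i' j ≡ + 0))))

Mon : ℕ → Set
Mon n = Σ (Mat n) IsMonomial

act : ∀ {n} → Mat n → Mat n → Mat n → Mat n
act L R X = L · X · R ᵀ

InClass : ∀ {n} → Mat n → Mat n → Set
InClass A B = ∃[ L ] ∃[ R ] (IsMonomial L × IsMonomial R × act L R A ≈ B)

SymmetricClass : ∀ {n} → Mat n → Set
SymmetricClass A = InClass A (A ᵀ)

IsSymmetric : ∀ {n} → Mat n → Set
IsSymmetric B = B ᵀ ≈ B

ClassHasSymmetric : ∀ {n} → Mat n → Set
ClassHasSymmetric A = ∃[ B ] (InClass A B × IsSymmetric B)

-- formal elements: pairs (L,R) and triples (L,R,⊤)
data TElem (n : ℕ) : Set where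
  pair   : Mat n → Mat n → TElem n
  triple : Mat n → Mat n → TElem n

InTAut : ∀ {n} → Mat n → TElem n → Set
InTAut A (pair L R)   = IsMonomial L × IsMonomial R × (L · A · R ᵀ ≈ A)
InTAut A (triple L R) = IsMonomial L × IsMonomial R × (L · A ᵀ · R ᵀ ≈ A)

-- group multiplication (composition of the operations)
_⊙_ : ∀ {n} → TElem n → TElem n → TElem n
pair L₁ R₁   ⊙ pair L₂ R₂   = pair (L₁ · L₂) (R₁ · R₂)
pair L₁ R₁   ⊙ triple L₂ R₂ = triple (L₁ · L₂) (R₁ · R₂)
triple L₁ R₁ ⊙ pair L₂ R₂   = triple (L₁ · R₂) (R₁ · L₂)
triple L₁ R₁ ⊙ triple L₂ R₂ = pair (L₁ · R₂) (R₁ · L₂)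

_≋_ : ∀ {n} → TElem n → TElem n → Set
pair L R   ≋ pair L' R'   = (L ≈ L') × (R ≈ R')
triple L R ≋ triple L' R' = (L ≈ L') × (R ≈ R')
_          ≋ _            = ⊥

parity : ∀ {n} → TElem n → Fin 2
parity (pair _ _)   = zero
parity (triple _ _) = suc zero

_+₂_ : Fin 2 → Fin 2 → Fin 2
zero +₂ b = b
suc zero +₂ zero = suc zero
suc zero +₂ suc zero = zero

Splits : ∀ {n} → Mat n → Set
Splits {n} A =
  Σ (Fin 2 → TElem n) λ s → ((∀ a → InTAut A (s a)) ×
          (∀ a b → s (a +₂ b) ≋ (s a ⊙ s b)) ×
          (∀ a → parity (s a) ≡ a))

{-# OPTIONS --safe #-}
-- A symmetric member B = P A Qᵀ of [A] yields the element t = (Pᵀ Q, Qᵀ P, ⊤)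
-- of TAut(A); it squares to the identity, so 1 ↦ t splits the sequence.
-- Conversely, a splitting sends 0 to an idempotent of TAut(A), which must be
-- the identity, so it sends 1 to some (L, R, ⊤) with R L = I.  Then B = R A lies
-- in [A] and is symmetric: Bᵀ = Aᵀ Rᵀ = R (L Aᵀ Rᵀ) = R A = B.
module Submission where

open import Defs
open import Data.Nat using (ℕ; zero; suc)
open import Data.Fin using (Fin; zero; suc; _≟_; punchIn)
open import Data.Fin.Properties using (punchInᵢ≢i)
open import Data.Integer using (ℤ; +_; _+_; _*_)
open import Data.Integer.Properties
  using (+-*-semiring; +-identityʳ; *-zeroʳ; *-identityˡ; *-identityʳ; *-assoc; *-comm; i*j≡0⇒i≡0∨j≡0)
open import Algebra.Properties.Semiring.Sum +-*-semiring
  using (sum; sum-cong-≗; sum-remove; sum-replicate-zero; ∑-comm; *-distribˡ-sum; *-distribʳ-sum)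
open import Data.Product using (∃-syntax; ∃₂; _×_; _,_; proj₁; proj₂)
open import Data.Sum using (inj₁; inj₂; [_,_]′)
open import Data.Empty using (⊥-elim)
open import Function.Base using (_∘_)
open import Function.Bundles using (_⇔_; mk⇔)
open import Relation.Nullary using (yes; no)
open import Relation.Binary.Bundles using (Setoid)
open import Relation.Binary.PropositionalEquality
import Relation.Binary.Reasoning.Setoid as SetoidReasoning

∑≡sum : ∀ {n} (f : Fin n → ℤ) → ∑ f ≡ sum f
∑≡sum {zero}  f = refl
∑≡sum {suc n} f = cong (_+_ (f zero)) (∑≡sum (f ∘ suc))

∑-cong : ∀ {n} {f g : Fin n → ℤ} → (∀ i → f i ≡ g i) → ∑ f ≡ ∑ g
∑-cong {zero}  f≗g = refl
∑-cong {suc n} f≗g = cong₂ _+_ (f≗g zero) (∑-cong (f≗g ∘ suc))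

∑-single : ∀ {n} (f : Fin n → ℤ) (c : Fin n) → (∀ k → k ≢ c → f k ≡ + 0) → ∑ f ≡ f c
∑-single {suc n} f c vanish = begin
  ∑ f                        ≡⟨ ∑≡sum f ⟩
  sum f                      ≡⟨ sum-remove {i = c} f ⟩
  f c + sum (f ∘ punchIn c)  ≡⟨ cong (_+_ (f c)) (sum-cong-≗ {n} λ k → vanish _ (punchInᵢ≢i c k)) ⟩
  f c + sum {n} (λ _ → + 0)  ≡⟨ cong (_+_ (f c)) (sum-replicate-zero n) ⟩
  f c + (+ 0)                ≡⟨ +-identityʳ (f c) ⟩
  f c                        ∎
  where open ≡-Reasoning

I-diagonal : ∀ {n} (i : Fin n) → I {n} i i ≡ + 1
I-diagonal i with i ≟ i
... | yes _   = refl
... | no i≢i  = ⊥-elim (i≢i refl)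

I-offDiagonal : ∀ {n} {i j : Fin n} → i ≢ j → I {n} i j ≡ + 0
I-offDiagonal {i = i} {j} i≢j with i ≟ j
... | yes i≡j = ⊥-elim (i≢j i≡j)
... | no _    = refl

module _ {n : ℕ} where

  ≈-refl : {X : Mat n} → X ≈ X
  ≈-refl i j = refl

  ≈-sym : {X Y : Mat n} → X ≈ Y → Y ≈ X
  ≈-sym X≈Y i j = sym (X≈Y i j)

  ≈-trans : {X Y Z : Mat n} → X ≈ Y → Y ≈ Z → X ≈ Z
  ≈-trans X≈Y Y≈Z i j = trans (X≈Y i j) (Y≈Z i j)

  ≈-setoid : Setoid _ _
  ≈-setoid = record
    { Carrier       = Mat n
    ; _≈_           = _≈_
    ; isEquivalence = record { refl = ≈-refl ; sym = ≈-sym ; trans = ≈-trans }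
    }

  ᵀ-cong : {X Y : Mat n} → X ≈ Y → X ᵀ ≈ Y ᵀ
  ᵀ-cong X≈Y i j = X≈Y j i

  ·-cong : {X X′ Y Y′ : Mat n} → X ≈ X′ → Y ≈ Y′ → X · Y ≈ X′ · Y′
  ·-cong X≈X′ Y≈Y′ i j = ∑-cong λ k → cong₂ _*_ (X≈X′ i k) (Y≈Y′ k j)

  ·-congˡ : (X : Mat n) {Y Y′ : Mat n} → Y ≈ Y′ → X · Y ≈ X · Y′
  ·-congˡ X = ·-cong {X = X} ≈-refl

  ·-congʳ : (Y : Mat n) {X X′ : Mat n} → X ≈ X′ → X · Y ≈ X′ · Y
  ·-congʳ Y X≈X′ = ·-cong {Y = Y} X≈X′ ≈-refl

  ·-assoc : (X Y Z : Mat n) → (X · Y) · Z ≈ X · (Y · Z)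
  ·-assoc X Y Z i j = begin
    ∑ (λ k → (X · Y) i k * Z k j)
      ≡⟨ ∑≡sum {n} _ ⟩
    sum (λ k → (X · Y) i k * Z k j)
      ≡⟨ sum-cong-≗ {n} (λ k → *-distribʳ-∑ (Z k j) _) ⟩
    sum (λ k → sum (λ l → X i l * Y l k * Z k j))
      ≡⟨ ∑-comm {n} {n} _ ⟩
    sum (λ l → sum (λ k → X i l * Y l k * Z k j))
      ≡⟨ sum-cong-≗ {n} (λ l → sum-cong-≗ {n} λ k → *-assoc (X i l) _ _) ⟩
    sum (λ l → sum (λ k → X i l * (Y l k * Z k j)))
      ≡˘⟨ sum-cong-≗ {n} (λ l → *-distribˡ-∑ (X i l) _) ⟩
    sum (λ l → X i l * (Y · Z) l j)
      ≡˘⟨ ∑≡sum {n} _ ⟩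
    ∑ (λ l → X i l * (Y · Z) l j)
      ∎
    where
    open ≡-Reasoning
    *-distribˡ-∑ : ∀ c (f : Fin n → ℤ) → c * ∑ f ≡ sum (λ k → c * f k)
    *-distribˡ-∑ c f = trans (cong (c *_) (∑≡sum f)) (*-distribˡ-sum c f)
    *-distribʳ-∑ : ∀ c (f : Fin n → ℤ) → ∑ f * c ≡ sum (λ k → f k * c)
    *-distribʳ-∑ c f = trans (cong (_* c) (∑≡sum f)) (*-distribʳ-sum c f)

  ᵀ-· : (X Y : Mat n) → (X · Y) ᵀ ≈ Y ᵀ · X ᵀ
  ᵀ-· X Y i j = ∑-cong λ k → *-comm (X j k) (Y k i)

  -- `with i ≟ j` also abstracts the test inside `I i j`, so that side reduces in each branch.
  Iᵀ≈I : I {n} ᵀ ≈ I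
  Iᵀ≈I i j with i ≟ j
  ... | yes refl = I-diagonal i
  ... | no i≢j   = I-offDiagonal (i≢j ∘ sym)

  ·-identityˡ : (X : Mat n) → I · X ≈ X
  ·-identityˡ X i j = begin
    ∑ (λ k → I i k * X k j)  ≡⟨ ∑-single _ i (λ k k≢i → cong (_* X k j) (I-offDiagonal (k≢i ∘ sym))) ⟩
    I i i * X i j            ≡⟨ cong (_* X i j) (I-diagonal i) ⟩
    + 1 * X i j              ≡⟨ *-identityˡ (X i j) ⟩
    X i j                    ∎
    where open ≡-Reasoning

  ·-identityʳ : (X : Mat n) → X · I ≈ X
  ·-identityʳ X i j = begin
    ∑ (λ k → X i k * I k j)  ≡⟨ ∑-single _ j (λ k k≢j → trans (cong (X i k *_) (I-offDiagonal k≢j)) (*-zeroʳ (X i k))) ⟩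
    X i j * I j j            ≡⟨ cong (X i j *_) (I-diagonal j) ⟩
    X i j * + 1              ≡⟨ *-identityʳ (X i j) ⟩
    X i j                    ∎
    where open ≡-Reasoning

  act-cong : {L L′ R R′ X X′ : Mat n} → L ≈ L′ → R ≈ R′ → X ≈ X′ → act L R X ≈ act L′ R′ X′
  act-cong L≈L′ R≈R′ X≈X′ = ·-cong (·-cong L≈L′ X≈X′) (ᵀ-cong R≈R′)

  act-congʳ : (L R : Mat n) {X X′ : Mat n} → X ≈ X′ → act L R X ≈ act L R X′
  act-congʳ L R = act-cong {L = L} {R = R} ≈-refl ≈-refl

  act-identity : (X : Mat n) → act I I X ≈ X
  act-identity X = begin
    (I · X) · I ᵀ  ≈⟨ ·-congˡ (I · X) Iᵀ≈I ⟩
    (I · X) · I    ≈⟨ ·-identityʳ (I · X) ⟩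
    I · X          ≈⟨ ·-identityˡ X ⟩
    X              ∎
    where open SetoidReasoning ≈-setoid

  act-∘ : (L R L′ R′ X : Mat n) → act L R (act L′ R′ X) ≈ act (L · L′) (R · R′) X
  act-∘ L R L′ R′ X = begin
    (L · ((L′ · X) · R′ ᵀ)) · R ᵀ   ≈⟨ ·-congʳ (R ᵀ) (≈-sym (·-assoc L (L′ · X) (R′ ᵀ))) ⟩
    ((L · (L′ · X)) · R′ ᵀ) · R ᵀ   ≈⟨ ·-congʳ (R ᵀ) (·-congʳ (R′ ᵀ) (≈-sym (·-assoc L L′ X))) ⟩
    (((L · L′) · X) · R′ ᵀ) · R ᵀ   ≈⟨ ·-assoc ((L · L′) · X) (R′ ᵀ) (R ᵀ) ⟩
    ((L · L′) · X) · (R′ ᵀ · R ᵀ)   ≈⟨ ·-congˡ ((L · L′) · X) (≈-sym (ᵀ-· R R′)) ⟩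
    ((L · L′) · X) · (R · R′) ᵀ     ∎
    where open SetoidReasoning ≈-setoid

  act-ᵀ : (L R X : Mat n) → act L R X ᵀ ≈ act R L (X ᵀ)
  act-ᵀ L R X = begin
    ((L · X) · R ᵀ) ᵀ    ≈⟨ ᵀ-· (L · X) (R ᵀ) ⟩
    R · (L · X) ᵀ        ≈⟨ ·-congˡ R (ᵀ-· L X) ⟩
    R · (X ᵀ · L ᵀ)      ≈⟨ ≈-sym (·-assoc R (X ᵀ) (L ᵀ)) ⟩
    (R · X ᵀ) · L ᵀ      ∎
    where open SetoidReasoning ≈-setoid

sign-* : ∀ {x y} → IsSignEntry x → IsSignEntry y → IsSignEntry (x * y)
sign-* (inj₁ refl)            _                      = inj₁ refl
sign-* {x} (inj₂ _)           (inj₁ refl)            = inj₁ (*-zeroʳ x)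
sign-* (inj₂ (inj₁ refl))     (inj₂ (inj₁ refl))     = inj₂ (inj₁ refl)
sign-* (inj₂ (inj₁ refl))     (inj₂ (inj₂ refl))     = inj₂ (inj₂ refl)
sign-* (inj₂ (inj₂ refl))     (inj₂ (inj₁ refl))     = inj₂ (inj₂ refl)
sign-* (inj₂ (inj₂ refl))     (inj₂ (inj₂ refl))     = inj₂ (inj₁ refl)

sign-square : ∀ {x} → IsSignEntry x → x ≢ + 0 → x * x ≡ + 1
sign-square (inj₁ x≡0)         x≢0 = ⊥-elim (x≢0 x≡0)
sign-square (inj₂ (inj₁ refl)) _   = refl
sign-square (inj₂ (inj₂ refl)) _   = refl

*-≢0 : ∀ {x y} → x ≢ + 0 → y ≢ + 0 → x * y ≢ + 0
*-≢0 {x} x≢0 y≢0 = [ x≢0 , y≢0 ]′ ∘ i*j≡0⇒i≡0∨j≡0 x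

module Monomial {n} {M : Mat n} (M-monomial : IsMonomial M) where

  sign : ∀ i j → IsSignEntry (M i j)
  sign = proj₁ M-monomial

  col : Fin n → Fin n
  col i = proj₁ (proj₁ (proj₂ M-monomial) i)

  col-≢0 : ∀ i → M i (col i) ≢ + 0
  col-≢0 i = proj₁ (proj₂ (proj₁ (proj₂ M-monomial) i))

  off-col : ∀ i j → j ≢ col i → M i j ≡ + 0
  off-col i = proj₂ (proj₂ (proj₁ (proj₂ M-monomial) i))

  row : Fin n → Fin n
  row j = proj₁ (proj₂ (proj₂ M-monomial) j)

  row-≢0 : ∀ j → M (row j) j ≢ + 0
  row-≢0 j = proj₁ (proj₂ (proj₂ (proj₂ M-monomial) j))

  off-row : ∀ j i → i ≢ row j → M i j ≡ + 0
  off-row j = proj₂ (proj₂ (proj₂ (proj₂ M-monomial) j))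

  row-col : ∀ i → row (col i) ≡ i
  row-col i with i ≟ row (col i)
  ... | yes i≡row = sym i≡row
  ... | no i≢row  = ⊥-elim (col-≢0 i (off-row (col i) i i≢row))

  ·-entryˡ : ∀ (X : Mat n) i j → (M · X) i j ≡ M i (col i) * X (col i) j
  ·-entryˡ X i j = ∑-single _ (col i) λ k k≢col → cong (_* X k j) (off-col i k k≢col)

  ·-entryʳ : ∀ (X : Mat n) i j → (X · M) i j ≡ X i (row j) * M (row j) j
  ·-entryʳ X i j = ∑-single _ (row j) λ k k≢row →
    trans (cong (X i k *_) (off-row j k k≢row)) (*-zeroʳ (X i k))

  ·-inverseʳ : M · M ᵀ ≈ I
  ·-inverseʳ i j with i ≟ j
  ... | yes refl = trans (·-entryˡ (M ᵀ) i i) (sign-square (sign i (col i)) (col-≢0 i))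
  ... | no i≢j   = begin
    (M · M ᵀ) i j             ≡⟨ ·-entryˡ (M ᵀ) i j ⟩
    M i (col i) * M j (col i) ≡⟨ cong (M i (col i) *_) (off-row (col i) j j≢row) ⟩
    M i (col i) * + 0         ≡⟨ *-zeroʳ (M i (col i)) ⟩
    + 0                       ∎
    where
    open ≡-Reasoning
    j≢row : j ≢ row (col i)
    j≢row j≡row = i≢j (trans (sym (row-col i)) (sym j≡row))

  idempotent⇒I : M ≈ M · M → M ≈ I
  idempotent⇒I M≈M² = begin
    M               ≈⟨ ≈-sym (·-identityʳ M) ⟩
    M · I           ≈⟨ ·-congˡ M (≈-sym ·-inverseʳ) ⟩
    M · (M · M ᵀ)   ≈⟨ ≈-sym (·-assoc M M (M ᵀ)) ⟩
    (M · M) · M ᵀ   ≈⟨ ·-congʳ (M ᵀ) (≈-sym M≈M²) ⟩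
    M · M ᵀ         ≈⟨ ·-inverseʳ ⟩
    I               ∎
    where open SetoidReasoning ≈-setoid

I-isMonomial : ∀ {n} → IsMonomial (I {n})
I-isMonomial = sign , (λ i → i , diagonal-≢0 i , λ j j≢i → I-offDiagonal (j≢i ∘ sym))
                    , (λ j → j , diagonal-≢0 j , λ i i≢j → I-offDiagonal i≢j)
  where
  sign : ∀ i j → IsSignEntry (I i j)
  sign i j with i ≟ j
  ... | yes _ = inj₂ (inj₁ refl)
  ... | no _  = inj₁ refl
  diagonal-≢0 : ∀ i → I i i ≢ + 0
  diagonal-≢0 i Iᵢᵢ≡0 with () ← trans (sym (I-diagonal i)) Iᵢᵢ≡0

ᵀ-isMonomial : ∀ {n} {M : Mat n} → IsMonomial M → IsMonomial (M ᵀ)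
ᵀ-isMonomial (sign , rows , cols) = (λ i j → sign j i) , cols , rows

·-isMonomial : ∀ {n} {M N : Mat n} → IsMonomial M → IsMonomial N → IsMonomial (M · N)
·-isMonomial {M = M} {N} M-monomial N-monomial = sign , rows , cols
  where
  module M = Monomial M-monomial
  module N = Monomial N-monomial
  sign : ∀ i j → IsSignEntry ((M · N) i j)
  sign i j = subst IsSignEntry (sym (M.·-entryˡ N i j)) (sign-* (M.sign i (M.col i)) (N.sign (M.col i) j))
  rows : ∀ i → ∃[ j ] ((M · N) i j ≢ + 0 × (∀ j′ → j′ ≢ j → (M · N) i j′ ≡ + 0))
  rows i = N.col (M.col i)
         , (*-≢0 (M.col-≢0 i) (N.col-≢0 (M.col i)) ∘ trans (sym (M.·-entryˡ N i _)))
         , λ j′ j′≢col → trans (M.·-entryˡ N i j′)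
                          (trans (cong (M i (M.col i) *_) (N.off-col (M.col i) j′ j′≢col)) (*-zeroʳ (M i (M.col i))))
  cols : ∀ j → ∃[ i ] ((M · N) i j ≢ + 0 × (∀ i′ → i′ ≢ i → (M · N) i′ j ≡ + 0))
  cols j = M.row (N.row j)
         , (*-≢0 (M.row-≢0 (N.row j)) (N.row-≢0 j) ∘ trans (sym (N.·-entryʳ M _ j)))
         , λ i′ i′≢row → trans (N.·-entryʳ M i′ j) (cong (_* N (N.row j) j) (M.off-row (N.row j) i′ i′≢row))

·-inverseʳ : ∀ {n} {M : Mat n} → IsMonomial M → M · M ᵀ ≈ I
·-inverseʳ = Monomial.·-inverseʳ

·-inverseˡ : ∀ {n} {M : Mat n} → IsMonomial M → M ᵀ · M ≈ I
·-inverseˡ = Monomial.·-inverseʳ ∘ ᵀ-isMonomial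

act-inverse : ∀ {n} {P Q : Mat n} → IsMonomial P → IsMonomial Q → (X : Mat n) →
              act (P ᵀ) (Q ᵀ) (act P Q X) ≈ X
act-inverse {P = P} {Q} P-monomial Q-monomial X = begin
  act (P ᵀ) (Q ᵀ) (act P Q X)  ≈⟨ act-∘ (P ᵀ) (Q ᵀ) P Q X ⟩
  act (P ᵀ · P) (Q ᵀ · Q) X    ≈⟨ act-cong (·-inverseˡ P-monomial) (·-inverseˡ Q-monomial) ≈-refl ⟩
  act I I X                    ≈⟨ act-identity X ⟩
  X                            ∎
  where open SetoidReasoning ≈-setoid

IsOddInvolution : ∀ {n} → Mat n → Mat n → Mat n → Set
IsOddInvolution A L R = InTAut A (triple L R) × (triple L R ⊙ triple L R) ≋ pair I I

classHasSymmetric⇒oddInvolution : ∀ {n} {A : Mat n} → ClassHasSymmetric A → ∃₂ (IsOddInvolution A)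
classHasSymmetric⇒oddInvolution {A = A} (B , (P , Q , P-monomial , Q-monomial , PAQᵀ≈B) , Bᵀ≈B) =
  P ᵀ · Q , Q ᵀ · P , (L-monomial , R-monomial , LAᵀRᵀ≈A) , LR≈I , RL≈I
  where
  L-monomial : IsMonomial (P ᵀ · Q)
  L-monomial = ·-isMonomial (ᵀ-isMonomial P-monomial) Q-monomial
  R-monomial : IsMonomial (Q ᵀ · P)
  R-monomial = ·-isMonomial (ᵀ-isMonomial Q-monomial) P-monomial
  LAᵀRᵀ≈A : act (P ᵀ · Q) (Q ᵀ · P) (A ᵀ) ≈ A
  LAᵀRᵀ≈A = begin
    act (P ᵀ · Q) (Q ᵀ · P) (A ᵀ)    ≈⟨ ≈-sym (act-∘ (P ᵀ) (Q ᵀ) Q P (A ᵀ)) ⟩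
    act (P ᵀ) (Q ᵀ) (act Q P (A ᵀ))  ≈⟨ act-congʳ (P ᵀ) (Q ᵀ) (≈-sym (act-ᵀ P Q A)) ⟩
    act (P ᵀ) (Q ᵀ) (act P Q A ᵀ)    ≈⟨ act-congʳ (P ᵀ) (Q ᵀ) (ᵀ-cong PAQᵀ≈B) ⟩
    act (P ᵀ) (Q ᵀ) (B ᵀ)            ≈⟨ act-congʳ (P ᵀ) (Q ᵀ) Bᵀ≈B ⟩
    act (P ᵀ) (Q ᵀ) B                ≈⟨ act-congʳ (P ᵀ) (Q ᵀ) (≈-sym PAQᵀ≈B) ⟩
    act (P ᵀ) (Q ᵀ) (act P Q A)      ≈⟨ act-inverse P-monomial Q-monomial A ⟩
    A                                ∎
    where open SetoidReasoning ≈-setoid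
  LR≈I : (P ᵀ · Q) · (Q ᵀ · P) ≈ I
  LR≈I = ≈-trans (·-congˡ (P ᵀ · Q) (≈-sym (ᵀ-· (P ᵀ) Q))) (·-inverseʳ L-monomial)
  RL≈I : (Q ᵀ · P) · (P ᵀ · Q) ≈ I
  RL≈I = ≈-trans (·-congˡ (Q ᵀ · P) (≈-sym (ᵀ-· (Q ᵀ) P))) (·-inverseʳ R-monomial)

oddInvolution⇒classHasSymmetric : ∀ {n} {A : Mat n} → ∃₂ (IsOddInvolution A) → ClassHasSymmetric A
oddInvolution⇒classHasSymmetric {A = A} (L , R , (_ , R-monomial , LAᵀRᵀ≈A) , _ , RL≈I) =
  act R I A , (R , I , R-monomial , I-isMonomial , ≈-refl) , symmetric
  where
  symmetric : act R I A ᵀ ≈ act R I A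
  symmetric = begin
    act R I A ᵀ              ≈⟨ act-ᵀ R I A ⟩
    act I R (A ᵀ)            ≈⟨ act-cong (≈-sym RL≈I) (≈-sym (·-identityˡ R)) ≈-refl ⟩
    act (R · L) (I · R) (A ᵀ) ≈⟨ ≈-sym (act-∘ R I L R (A ᵀ)) ⟩
    act R I (act L R (A ᵀ))  ≈⟨ act-congʳ R I LAᵀRᵀ≈A ⟩
    act R I A                ∎
    where open SetoidReasoning ≈-setoid

oddInvolution⇒splits : ∀ {n} {A : Mat n} → ∃₂ (IsOddInvolution A) → Splits A
oddInvolution⇒splits {n} {A} (L , R , t∈TAut , LR≈I , RL≈I) = s , s∈TAut , s-homomorphism , s-section
  where
  s : Fin 2 → TElem n
  s zero       = pair I I
  s (suc zero) = triple L R
  s∈TAut : ∀ a → InTAut A (s a)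
  s∈TAut zero       = I-isMonomial , I-isMonomial , act-identity A
  s∈TAut (suc zero) = t∈TAut
  s-homomorphism : ∀ a b → s (a +₂ b) ≋ (s a ⊙ s b)
  s-homomorphism zero       zero       = ≈-sym (·-identityˡ I) , ≈-sym (·-identityˡ I)
  s-homomorphism zero       (suc zero) = ≈-sym (·-identityˡ L) , ≈-sym (·-identityˡ R)
  s-homomorphism (suc zero) zero       = ≈-sym (·-identityʳ L) , ≈-sym (·-identityʳ R)
  s-homomorphism (suc zero) (suc zero) = ≈-sym LR≈I , ≈-sym RL≈I
  s-section : ∀ a → parity (s a) ≡ a
  s-section zero       = refl
  s-section (suc zero) = refl

splits⇒oddInvolution : ∀ {n} {A : Mat n} → Splits A → ∃₂ (IsOddInvolution A)
splits⇒oddInvolution {A = A} (s , s∈TAut , s-homomorphism , s-section) =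
  fromImages (s zero) (s (suc zero)) (s∈TAut zero) (s∈TAut (suc zero))
             (s-homomorphism zero zero) (s-homomorphism (suc zero) (suc zero)) (s-section (suc zero))
  where
  fromImages : ∀ e t → InTAut A e → InTAut A t → e ≋ (e ⊙ e) → e ≋ (t ⊙ t) → parity t ≡ suc zero →
               ∃₂ (IsOddInvolution A)
  fromImages (pair L₀ R₀) (triple L R) (L₀-monomial , R₀-monomial , _) t∈TAut
             (L₀≈L₀² , R₀≈R₀²) (L₀≈LR , R₀≈RL) _ =
    L , R , t∈TAut
      , ≈-trans (≈-sym L₀≈LR) (Monomial.idempotent⇒I L₀-monomial L₀≈L₀²)
      , ≈-trans (≈-sym R₀≈RL) (Monomial.idempotent⇒I R₀-monomial R₀≈R₀²)
  fromImages (triple _ _) _            _ _ () _ _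
  fromImages (pair _ _)   (pair _ _)   _ _ _  _ ()

proposition5p4 : ∀ (n : ℕ) (A : Mat n) → IsWeighing A → SymmetricClass A → (ClassHasSymmetric A ⇔ Splits A)
proposition5p4 n A _ _ = mk⇔
  (oddInvolution⇒splits ∘ classHasSymmetric⇒oddInvolution)
  (oddInvolution⇒classHasSymmetric ∘ splits⇒oddInvolution)
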